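{- Let $q$ be a power of a prime $p$ and $n\ge1$ with $\gcd(n,\log_pq)=1$. For $e_0,\dots,e_{n-1}\in\mathbb{Z}$, $x_0^{e_0}\cdots x_{n-1}^{e_{n-1}}\in\mathcal{G}(n,q)$ if and only if $e_0+e_1q^{1/n}+\cdots+e_{n-1}q^{(n-1)/n}\in\mathbb{Z}[q^{1/n}]^\times$. Moreover, the map $\phi_n:\mathbb{Z}[q^{1/n}]^\times\to\mathcal{G}(n,q)$, $e_0+e_1q^{1/n}+\cdots+e_{n-1}q^{(n-1)/n}\mapsto x_0^{e_0}\cdots x_{n-1}^{e_{n-1}}$ ($e_i\in\mathbb{Z}$), is an injective group homomorphism.
   Context: $q^{1/n}$ is the positive real $n$-th root of $q$ (here $x^n-q$ is irreducible over $\mathbb{Q}$, so every element of $\mathbb{Z}[q^{1/n}]$ has a unique such representation), and $\mathbb{Z}[q^{1/n}]^\times$ is the multiplicative group of units of the ring $\mathbb{Z}[q^{1/n}]$. Let $(\ )^*$ be the $\mathbb{F}_q$-algebra monomorphism of $\mathbb{F}_q(x_0,\dots,x_{n-1})$ with $x_i^*=x_{i+1}$ for $0\le i<n-1$ and $x_{n-1}^*=x_0^q$; for $g\notin\mathbb{F}_q$, $f\circ g:=f(g,g^*,\dots,g^{(n-1)*})$. $(\mathbb{F}_q(x_0,\dots,x_{n-1})\setminus\mathbb{F}_q,\circ)$ is a monoid with identity $x_0$, and $\mathcal{G}(n,q)$ is its group of invertible elements. -}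

module Defs where

open import Level using (Level; _⊔_) renaming (suc to lsuc)
open import Algebra.Bundles using (CommutativeRing)
open import Data.Nat as ℕ using (ℕ; zero; suc)
open import Data.Integer as ℤ using (ℤ; +_; -[1+_])
open import Data.Fin using (Fin; toℕ)
import Data.Fin as Fin
open import Data.Vec using (Vec; _∷_; []; replicate; tabulate; zipWith; init; last; _[_]≔_)
open import Data.Vec.Properties using (≡-dec)
open import Data.List using (List; []; _∷_; _++_; map; concatMap)
open import Data.Product using (_×_; _,_; ∃; proj₁; proj₂)
open import Relation.Nullary using (¬_; yes; no)
open import Relation.Binary.PropositionalEquality using (_≡_)

record Field (c ℓ : Level) : Set (lsuc (c ⊔ ℓ)) where
  field
    commutativeRing : CommutativeRing c ℓ
  open CommutativeRing commutativeRing public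
  field
    1≉0     : ¬ (1# ≈ 0#)
    inverse : ∀ x → ¬ (x ≈ 0#) → ∃ λ y → (x * y) ≈ 1#

-- The ring Z[q^{1/n}] with n = suc k, represented (uniquely, since
-- x^n - q is irreducible) by coefficient vectors (e_0,…,e_{n-1}) of
-- e_0 + e_1 q^{1/n} + … + e_{n-1} q^{(n-1)/n}.  Multiplication uses
-- (q^{1/n})^n = q.

sumFin : ∀ {n} → (Fin n → ℤ) → ℤ
sumFin {zero}  f = + 0
sumFin {suc n} f = f Fin.zero ℤ.+ sumFin (λ i → f (Fin.suc i))

module Root (q k : ℕ) where

  n : ℕ
  n = suc k

  ZRoot : Set
  ZRoot = Fin n → ℤ

  _≈Z_ : ZRoot → ZRoot → Set
  a ≈Z b = ∀ i → a i ≡ b i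

  oneZ : ZRoot
  oneZ Fin.zero    = + 1
  oneZ (Fin.suc _) = + 0

  -- contribution of a_i q^{i/n} * b_j q^{j/n} to the coefficient of q^{l/n}
  contrib : ZRoot → ZRoot → Fin n → Fin n → Fin n → ℤ
  contrib a b l i j with toℕ i ℕ.+ toℕ j ℕ.≟ toℕ l
  ... | yes _ = a i ℤ.* b j
  ... | no _ with toℕ i ℕ.+ toℕ j ℕ.≟ toℕ l ℕ.+ n
  ...   | yes _ = (+ q) ℤ.* (a i ℤ.* b j)
  ...   | no _  = + 0

  _*Z_ : ZRoot → ZRoot → ZRoot
  (a *Z b) l = sumFin (λ i → sumFin (λ j → contrib a b l i j))

  IsUnit : ZRoot → Set
  IsUnit a = ∃ λ b → ((a *Z b) ≈Z oneZ) × ((b *Z a) ≈Z oneZ)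

module Setup {c ℓ} (F : Field c ℓ) (q k : ℕ) where
  open Field F renaming (Carrier to K)
  open Root q k public

  Exp : Set
  Exp = Vec ℕ n

  Poly : Set c
  Poly = List (K × Exp)

  coeff : Poly → Exp → K
  coeff []              m = 0#
  coeff ((a , m') ∷ ts) m with ≡-dec ℕ._≟_ m' m
  ... | yes _ = a + coeff ts m
  ... | no _  = coeff ts m

  _≈P_ : Poly → Poly → Set ℓ
  p ≈P r = ∀ m → coeff p m ≈ coeff r m

  zeroP : Poly
  zeroP = []

  constP : K → Poly
  constP a = (a , replicate n 0) ∷ []

  oneP : Poly
  oneP = constP 1#

  varP : Fin n → Poly
  varP i = (1# , (replicate n 0 [ i ]≔ 1)) ∷ []

  _+P_ : Poly → Poly → Poly
  _+P_ = _++_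

  _*P_ : Poly → Poly → Poly
  p *P r = concatMap (λ t → map (λ u → (proj₁ t * proj₁ u , zipWith ℕ._+_ (proj₂ t) (proj₂ u))) r) p

  powP : Poly → ℕ → Poly
  powP p zero    = oneP
  powP p (suc e) = p *P powP p e

  prodFin : ∀ {m} → (Fin m → Poly) → Poly
  prodFin {zero}  f = oneP
  prodFin {suc m} f = f Fin.zero *P prodFin (λ i → f (Fin.suc i))

  -- rational functions as fractions num/den (den ≠ 0 imposed separately)
  record RatFun : Set c where
    constructor _/_
    field
      num : Poly
      den : Poly
  open RatFun public

  WF : RatFun → Set ℓ
  WF f = ¬ (den f ≈P zeroP)

  _≈R_ : RatFun → RatFun → Set ℓ
  f ≈R g = (num f *P den g) ≈P (num g *P den f)

  IsConst : RatFun → Set (c ⊔ ℓ)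
  IsConst f = ∃ λ a → num f ≈P (constP a *P den f)

  -- the F_q-algebra map ( )^*: x_i ↦ x_{i+1} (i < n-1), x_{n-1} ↦ x_0^q,
  -- acting on the exponent vector of a monomial
  starExp : Exp → Exp
  starExp m = (q ℕ.* last m) ∷ init m

  starP : Poly → Poly
  starP = map (λ t → (proj₁ t , starExp (proj₂ t)))

  star : RatFun → RatFun
  star f = starP (num f) / starP (den f)

  iterStar : ℕ → RatFun → RatFun
  iterStar zero    f = f
  iterStar (suc i) f = star (iterStar i f)

  _+R_ : RatFun → RatFun → RatFun
  f +R g = ((num f *P den g) +P (num g *P den f)) / (den f *P den g)

  evalTerm : (Fin n → RatFun) → K × Exp → RatFun
  evalTerm rs (a , m) =
    (constP a *P prodFin (λ i → powP (num (rs i)) (Data.Vec.lookup m i)))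
    / prodFin (λ i → powP (den (rs i)) (Data.Vec.lookup m i))

  evalP : Poly → (Fin n → RatFun) → RatFun
  evalP []       rs = zeroP / oneP
  evalP (t ∷ ts) rs = evalTerm rs t +R evalP ts rs

  -- Comp f g h  means  f ∘ g = h, where f ∘ g = f(g, g^*, …, g^{(n-1)*});
  -- it includes that the denominator of f does not vanish at these arguments.
  Comp : RatFun → RatFun → RatFun → Set ℓ
  Comp f g h =
    let gs = λ (i : Fin n) → iterStar (toℕ i) g
        N  = evalP (num f) gs
        D  = evalP (den f) gs
    in ¬ (num D ≈P zeroP) × (((num N *P den D) / (den N *P num D)) ≈R h)

  Elt : RatFun → Set (c ⊔ ℓ)
  Elt f = WF f × ¬ IsConst f

  x0 : RatFun
  x0 = varP Fin.zero / oneP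

  -- f ∈ G(n,q): f is invertible in the monoid (identity x_0)
  InG : RatFun → Set (c ⊔ ℓ)
  InG f = Elt f × ∃ λ g → Elt g × Comp f g x0 × Comp g f x0

  posPart : ℤ → ℕ
  posPart (+ a)     = a
  posPart -[1+ a ]  = 0

  negPart : ℤ → ℕ
  negPart (+ a)     = 0
  negPart -[1+ a ]  = suc a

  mono : ZRoot → RatFun
  mono e = ((1# , tabulate (λ i → posPart (e i))) ∷ [])
         / ((1# , tabulate (λ i → negPart (e i))) ∷ [])

-- For each variable x_j the x_j-degree of polynomials over a field is additive on products
-- (compare leading monomials for the order "x_j-exponent first, then lexicographic").  Since ( )^*
-- sends x_j to x_{j+1} and x_{n-1} to x_0^q, it transforms the degree vector (deg_0 p, …, deg_{n-1} p)
-- exactly as multiplication by θ = q^{1/n} transforms coefficient vectors in ℤ[θ].  Hence if u and v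
-- are the degree vectors of the numerator and denominator of g, those of x^e ∘ g differ by e · (u − v)
-- computed in ℤ[θ]; if x^e ∘ g = x_0 this product is 1, so e is a unit.  Monomials follow the same rule
-- exactly, x^a ∘ x^b = x^{ab}, which gives the inverse of x^e, the homomorphism property, and
-- injectivity by comparing exponents.  Both computations are instances of one argument about ℤⁿ-valued
-- invariants of polynomials that are additive on products and on which ( )^* acts as multiplication by θ.

module Submission where

open import Level using (_⊔_) renaming (suc to lsuc)
open import Algebra.Bundles using (CommutativeMonoid)
import Algebra.Properties.CommutativeMonoid.Sum as MonoidSum
open import Data.Fin using (Fin; zero; suc; toℕ; fromℕ; inject₁)
import Data.Fin.Properties as FinP
open import Data.Integer as ℤ using (ℤ; +_; -[1+_])
import Data.Integer.Properties as ℤP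
open import Data.Integer.Tactic.RingSolver using (solve-∀)
open import Data.List using ([]; _∷_; _++_; map; length)
import Data.List.Properties as ListP
open import Data.List.Relation.Unary.Any using (Any; here; there)
open import Data.Nat as ℕ using (ℕ; zero; suc; _≤_; _^_)
open import Data.Nat.GCD using (gcd)
open import Data.Nat.Primality using (Prime; prime⇒nonZero)
import Data.Nat.Properties as ℕP
open import Data.Product using (Σ; ∃; _×_; _,_; proj₁; proj₂)
open import Data.Sum using (_⊎_; inj₁; inj₂)
open import Data.Unit using (tt)
open import Data.Vec using (Vec; _∷_; []; zipWith; lookup; tabulate; replicate; _[_]≔_; init; last; initLast; _∷ʳ_)
open import Data.Vec.Functional as Vector using (Vector; removeAt)
import Data.Vec.Properties as VecP
open VecP using (≡-dec)
open import Data.Vec.Relation.Binary.Lex.Core {A = ℕ} using (Lex; base; this; next; map-P)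
open import Data.Vec.Relation.Binary.Lex.Strict as Lex using (Lex-<; Lex-≤)
import Data.Vec.Relation.Binary.Pointwise.Inductive as Pointwise
open import Function.Base using (id)
open import Function.Bundles using (Bijection; Equivalence; _⇔_; mk⇔)
open import Relation.Binary.Definitions using (Decidable)
open import Relation.Binary.PropositionalEquality as ≡ using (_≡_; _≢_)
open import Relation.Binary.Structures using (IsEquivalence; IsPartialEquivalence)
open import Relation.Nullary using (¬_; yes; no; contradiction)
open import Relation.Nullary.Decidable using (decidable-stable; via-injection)
open import Defs

module _ {a ℓ} (M : CommutativeMonoid a ℓ) where
  open CommutativeMonoid M
  open MonoidSum M
  open import Relation.Binary.Reasoning.Setoid setoid

  sum-single : ∀ {m} (t : Vector Carrier (suc m)) i → (∀ j → j ≢ i → t j ≈ ε) → sum t ≈ t i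
  sum-single {m} t i others = begin
    sum t                       ≈⟨ sum-remove t ⟩
    t i ∙ sum (removeAt t i)    ≈⟨ ∙-congˡ (sum-cong-≋ {m} (λ j → others _ (FinP.punchInᵢ≢i i j))) ⟩
    t i ∙ sum (Vector.replicate m ε)   ≈⟨ ∙-congˡ (sum-replicate-zero m) ⟩
    t i ∙ ε                     ≈⟨ identityʳ (t i) ⟩
    t i                         ∎

open MonoidSum ℤP.+-0-commutativeMonoid using (sum; sum-cong-≗; ∑-distrib-+; ∑-comm; sum-replicate-zero)

sumFin≡sum : ∀ {m} (f : Fin m → ℤ) → sumFin f ≡ sum f
sumFin≡sum {zero}  f = ≡.refl
sumFin≡sum {suc m} f = ≡.cong (λ s → f zero ℤ.+ s) (sumFin≡sum (λ i → f (suc i)))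

sum-distrib-− : ∀ {m} (f g : Fin m → ℤ) → sum (λ i → f i ℤ.- g i) ≡ sum f ℤ.- sum g
sum-distrib-− {zero}  f g = ≡.refl
sum-distrib-− {suc m} f g =
  ≡.trans (≡.cong (λ s → f zero ℤ.- g zero ℤ.+ s) (sum-distrib-− (λ i → f (suc i)) (λ i → g (suc i))))
        (regroup (f zero) (g zero) (sum (λ i → f (suc i))) (sum (λ i → g (suc i))))
  where
  regroup : ∀ a b x y → a ℤ.- b ℤ.+ (x ℤ.- y) ≡ a ℤ.+ x ℤ.- (b ℤ.+ y)
  regroup = solve-∀

+≡+⇔-≡- : ∀ a b c d → (a ℤ.+ d ≡ c ℤ.+ b) ⇔ (a ℤ.- b ≡ c ℤ.- d)
+≡+⇔-≡- a b c d = mk⇔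
  (λ eq → ≡.trans (from-sum a b d) (≡.trans (≡.cong (λ s → s ℤ.- b ℤ.- d) eq) (cancel c b d)))
  (λ eq → ≡.trans (to-sum a b d) (≡.trans (≡.cong (λ s → s ℤ.+ b ℤ.+ d) eq) (uncancel c b d)))
  where
  from-sum : ∀ x y z → x ℤ.- y ≡ x ℤ.+ z ℤ.- y ℤ.- z
  from-sum = solve-∀
  cancel : ∀ x y z → x ℤ.+ y ℤ.- y ℤ.- z ≡ x ℤ.- z
  cancel = solve-∀
  to-sum : ∀ x y z → x ℤ.+ z ≡ x ℤ.- y ℤ.+ y ℤ.+ z
  to-sum = solve-∀
  uncancel : ∀ x y z → x ℤ.- z ℤ.+ y ℤ.+ z ≡ x ℤ.+ y
  uncancel = solve-∀

-- Arithmetic in ℤ[q^{1/n}]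

module ZRootArithmetic (q k : ℕ) where
  open Root q k
  open ≡ using (refl; sym; trans; cong; cong₂; subst; module ≡-Reasoning)

  infixl 6 _-Z_
  _-Z_ : ZRoot → ZRoot → ZRoot
  (a -Z b) i = a i ℤ.- b i

  -- multiplication by q^{1/n}
  shift : ZRoot → ZRoot
  shift w zero    = + q ℤ.* w (fromℕ k)
  shift w (suc i) = w (inject₁ i)

  shift^ : ℕ → ZRoot → ZRoot
  shift^ zero    w = w
  shift^ (suc i) w = shift (shift^ i w)

  data ShiftSource (i : ℕ) (b : ZRoot) (l : Fin n) : Set where
    direct  : ∀ j → i ℕ.+ toℕ j ≡ toℕ l → shift^ i b l ≡ b j → ShiftSource i b l
    wrapped : ∀ j → i ℕ.+ toℕ j ≡ toℕ l ℕ.+ n → shift^ i b l ≡ + q ℤ.* b j → ShiftSource i b l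

  shift^-source : ∀ {i} → i ℕ.< n → ∀ b l → ShiftSource i b l
  shift^-source {zero}  _ b l = direct l refl refl
  shift^-source {suc i} (ℕ.s≤s i<k) b zero with shift^-source (ℕP.m<n⇒m<1+n i<k) b (fromℕ k)
  ... | direct j e v  = wrapped j (cong suc (trans e (FinP.toℕ-fromℕ k))) (cong (+ q ℤ.*_) v)
  ... | wrapped j e _ =
    contradiction (ℕP.+-mono-< i<k (FinP.toℕ<n j)) (ℕP.<-irrefl (trans e (cong (ℕ._+ n) (FinP.toℕ-fromℕ k))))
  shift^-source {suc i} (ℕ.s≤s i<k) b (suc l) with shift^-source (ℕP.m<n⇒m<1+n i<k) b (inject₁ l)
  ... | direct j e v  = direct j (cong suc (trans e (FinP.toℕ-inject₁ l))) v
  ... | wrapped j e v = wrapped j (cong suc (trans e (cong (ℕ._+ n) (FinP.toℕ-inject₁ l)))) v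

  private
    n≢0+n : ∀ {x} → x ≢ x ℕ.+ n
    n≢0+n {x} e = ℕP.m≢1+m+n x (trans e (ℕP.+-suc x k))

  contrib-direct : ∀ a b l i j → toℕ i ℕ.+ toℕ j ≡ toℕ l → contrib a b l i j ≡ a i ℤ.* b j
  contrib-direct a b l i j e with toℕ i ℕ.+ toℕ j ℕ.≟ toℕ l
  ... | yes _ = refl
  ... | no ne = contradiction e ne

  contrib-wrapped : ∀ a b l i j → toℕ i ℕ.+ toℕ j ≡ toℕ l ℕ.+ n → contrib a b l i j ≡ + q ℤ.* (a i ℤ.* b j)
  contrib-wrapped a b l i j e with toℕ i ℕ.+ toℕ j ℕ.≟ toℕ l
  ... | yes e' = contradiction (trans (sym e') e) n≢0+n
  ... | no _ with toℕ i ℕ.+ toℕ j ℕ.≟ toℕ l ℕ.+ n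
  ...   | yes _ = refl
  ...   | no ne = contradiction e ne

  contrib-none : ∀ a b l i j → toℕ i ℕ.+ toℕ j ≢ toℕ l → toℕ i ℕ.+ toℕ j ≢ toℕ l ℕ.+ n →
                 contrib a b l i j ≡ + 0
  contrib-none a b l i j ne ne' with toℕ i ℕ.+ toℕ j ℕ.≟ toℕ l
  ... | yes e = contradiction e ne
  ... | no _ with toℕ i ℕ.+ toℕ j ℕ.≟ toℕ l ℕ.+ n
  ...   | yes e = contradiction e ne'
  ...   | no _  = refl

  private
    cancel : ∀ i {j j' : Fin n} → i ℕ.+ toℕ j ≡ i ℕ.+ toℕ j' → j ≡ j'
    cancel i e = FinP.toℕ-injective (ℕP.+-cancelˡ-≡ i _ _ e)

    no-overflow : ∀ i (j j' : Fin n) → i ℕ.+ toℕ j ≢ (i ℕ.+ toℕ j') ℕ.+ n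
    no-overflow i j j' e = ℕP.<⇒≱ (FinP.toℕ<n j) (subst (n ℕ.≤_) (sym j≡j'+n) (ℕP.m≤n+m n (toℕ j')))
      where
      j≡j'+n : toℕ j ≡ toℕ j' ℕ.+ n
      j≡j'+n = ℕP.+-cancelˡ-≡ i _ _ (trans e (ℕP.+-assoc i (toℕ j') n))

  contrib-row : ∀ a b l i → sumFin (contrib a b l i) ≡ a i ℤ.* shift^ (toℕ i) b l
  contrib-row a b l i with shift^-source (FinP.toℕ<n i) b l
  ... | direct j₀ e v = begin
    sumFin (contrib a b l i)  ≡⟨ sumFin≡sum (contrib a b l i) ⟩
    sum (contrib a b l i)     ≡⟨ sum-single ℤP.+-0-commutativeMonoid _ j₀ others ⟩
    contrib a b l i j₀        ≡⟨ contrib-direct a b l i j₀ e ⟩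
    a i ℤ.* b j₀              ≡⟨ cong (a i ℤ.*_) v ⟨
    a i ℤ.* shift^ (toℕ i) b l ∎
    where
    open ≡-Reasoning
    others : ∀ j → j ≢ j₀ → contrib a b l i j ≡ + 0
    others j j≢j₀ = contrib-none a b l i j
      (λ e' → j≢j₀ (cancel (toℕ i) (trans e' (sym e))))
      (λ e' → no-overflow (toℕ i) j j₀ (trans e' (cong (ℕ._+ n) (sym e))))
  ... | wrapped j₀ e v = begin
    sumFin (contrib a b l i)  ≡⟨ sumFin≡sum (contrib a b l i) ⟩
    sum (contrib a b l i)     ≡⟨ sum-single ℤP.+-0-commutativeMonoid _ j₀ others ⟩
    contrib a b l i j₀        ≡⟨ contrib-wrapped a b l i j₀ e ⟩
    + q ℤ.* (a i ℤ.* b j₀)    ≡⟨ ℤP.*-comm (+ q) _ ⟩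
    a i ℤ.* b j₀ ℤ.* + q      ≡⟨ ℤP.*-assoc (a i) _ _ ⟩
    a i ℤ.* (b j₀ ℤ.* + q)    ≡⟨ cong (a i ℤ.*_) (trans (ℤP.*-comm (b j₀) (+ q)) (sym v)) ⟩
    a i ℤ.* shift^ (toℕ i) b l ∎
    where
    open ≡-Reasoning
    others : ∀ j → j ≢ j₀ → contrib a b l i j ≡ + 0
    others j j≢j₀ = contrib-none a b l i j
      (λ e' → no-overflow (toℕ i) j₀ j (trans e (cong (ℕ._+ n) (sym e'))))
      (λ e' → j≢j₀ (cancel (toℕ i) (trans e' (sym e))))

  *Z-by-shifts : ∀ a b l → (a *Z b) l ≡ sum (λ i → a i ℤ.* shift^ (toℕ i) b l)
  *Z-by-shifts a b l = trans (sumFin≡sum (λ i → sumFin (contrib a b l i))) (sum-cong-≗ {n} (contrib-row a b l))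

  contrib-sym : ∀ a b l i j → contrib a b l i j ≡ contrib b a l j i
  contrib-sym a b l i j with toℕ i ℕ.+ toℕ j ℕ.≟ toℕ l
  ... | yes e = sym (trans (contrib-direct b a l j i (trans (ℕP.+-comm (toℕ j) (toℕ i)) e)) (ℤP.*-comm (b j) (a i)))
  ... | no ne with toℕ i ℕ.+ toℕ j ℕ.≟ toℕ l ℕ.+ n
  ...   | yes e = sym (trans (contrib-wrapped b a l j i (trans (ℕP.+-comm (toℕ j) (toℕ i)) e))
                              (cong (+ q ℤ.*_) (ℤP.*-comm (b j) (a i))))
  ...   | no ne' = sym (contrib-none b a l j i (λ e → ne (trans (ℕP.+-comm (toℕ i) (toℕ j)) e))
                                              (λ e → ne' (trans (ℕP.+-comm (toℕ i) (toℕ j)) e)))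

  *Z-comm : ∀ a b → (a *Z b) ≈Z (b *Z a)
  *Z-comm a b l = begin
    (a *Z b) l                                    ≡⟨ sumFin≡sum (λ i → sumFin (contrib a b l i)) ⟩
    sum (λ i → sumFin (contrib a b l i))          ≡⟨ sum-cong-≗ {n} (λ i → sumFin≡sum (contrib a b l i)) ⟩
    sum (λ i → sum (λ j → contrib a b l i j))     ≡⟨ sum-cong-≗ {n} (λ i → sum-cong-≗ {n} (contrib-sym a b l i)) ⟩
    sum (λ i → sum (λ j → contrib b a l j i))     ≡⟨ ∑-comm (λ i j → contrib b a l j i) ⟩
    sum (λ j → sum (λ i → contrib b a l j i))     ≡⟨ sum-cong-≗ {n} (λ j → sumFin≡sum (contrib b a l j)) ⟨
    sum (λ j → sumFin (contrib b a l j))          ≡⟨ sumFin≡sum (λ j → sumFin (contrib b a l j)) ⟨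
    (b *Z a) l                                    ∎
    where open ≡-Reasoning

  shift^-cong : ∀ {b b'} → b ≈Z b' → ∀ i l → shift^ i b l ≡ shift^ i b' l
  shift^-cong b≈b' zero    l       = b≈b' l
  shift^-cong b≈b' (suc i) zero    = cong (+ q ℤ.*_) (shift^-cong b≈b' i (fromℕ k))
  shift^-cong b≈b' (suc i) (suc l) = shift^-cong b≈b' i (inject₁ l)

  *Z-cong : ∀ {a a' b b'} → a ≈Z a' → b ≈Z b' → (a *Z b) ≈Z (a' *Z b')
  *Z-cong {a} {a'} {b} {b'} a≈a' b≈b' l = begin
    (a *Z b) l                                      ≡⟨ *Z-by-shifts a b l ⟩
    sum (λ i → a i ℤ.* shift^ (toℕ i) b l)          ≡⟨ sum-cong-≗ {n} (λ i → cong₂ ℤ._*_ (a≈a' i) (shift^-cong b≈b' (toℕ i) l)) ⟩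
    sum (λ i → a' i ℤ.* shift^ (toℕ i) b' l)        ≡⟨ *Z-by-shifts a' b' l ⟨
    (a' *Z b') l                                    ∎
    where open ≡-Reasoning

  *Z-zeroˡ : ∀ {a} b → (∀ i → a i ≡ + 0) → ∀ l → (a *Z b) l ≡ + 0
  *Z-zeroˡ {a} b a≈0 l = begin
    (a *Z b) l                               ≡⟨ *Z-by-shifts a b l ⟩
    sum (λ i → a i ℤ.* shift^ (toℕ i) b l)   ≡⟨ sum-cong-≗ {n} (λ i → cong (ℤ._* shift^ (toℕ i) b l) (a≈0 i)) ⟩
    sum {n} (λ _ → + 0)                      ≡⟨ sum-replicate-zero n ⟩
    + 0                                      ∎
    where open ≡-Reasoning

  shift^-distrib-− : ∀ x y i l → shift^ i (x -Z y) l ≡ shift^ i x l ℤ.- shift^ i y l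
  shift^-distrib-− x y zero    l       = refl
  shift^-distrib-− x y (suc i) zero    =
    trans (cong (+ q ℤ.*_) (shift^-distrib-− x y i (fromℕ k))) (distrib (+ q) _ _)
    where
    distrib : ∀ c u v → c ℤ.* (u ℤ.- v) ≡ c ℤ.* u ℤ.- c ℤ.* v
    distrib = solve-∀
  shift^-distrib-− x y (suc i) (suc l) = shift^-distrib-− x y i (inject₁ l)

  *Z-expand : ∀ a b c d l →
    ((a -Z b) *Z (c -Z d)) l ≡ ((a *Z c) l ℤ.+ (b *Z d) l) ℤ.- ((a *Z d) l ℤ.+ (b *Z c) l)
  *Z-expand a b c d l = begin
    ((a -Z b) *Z (c -Z d)) l
      ≡⟨ *Z-by-shifts (a -Z b) (c -Z d) l ⟩
    sum (λ i → (a i ℤ.- b i) ℤ.* shift^ (toℕ i) (c -Z d) l)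
      ≡⟨ sum-cong-≗ {n} (λ i → trans (cong ((a i ℤ.- b i) ℤ.*_) (shift^-distrib-− c d (toℕ i) l)) (expand (a i) (b i) (C i) (D i))) ⟩
    sum (λ i → (a i ℤ.* C i ℤ.+ b i ℤ.* D i) ℤ.- (a i ℤ.* D i ℤ.+ b i ℤ.* C i))
      ≡⟨ sum-distrib-− (λ i → a i ℤ.* C i ℤ.+ b i ℤ.* D i) (λ i → a i ℤ.* D i ℤ.+ b i ℤ.* C i) ⟩
    sum (λ i → a i ℤ.* C i ℤ.+ b i ℤ.* D i) ℤ.- sum (λ i → a i ℤ.* D i ℤ.+ b i ℤ.* C i)
      ≡⟨ cong₂ ℤ._-_ (∑-distrib-+ (λ i → a i ℤ.* C i) (λ i → b i ℤ.* D i)) (∑-distrib-+ (λ i → a i ℤ.* D i) (λ i → b i ℤ.* C i)) ⟩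
    (sum (λ i → a i ℤ.* C i) ℤ.+ sum (λ i → b i ℤ.* D i)) ℤ.- (sum (λ i → a i ℤ.* D i) ℤ.+ sum (λ i → b i ℤ.* C i))
      ≡⟨ cong₂ ℤ._-_ (cong₂ ℤ._+_ (*Z-by-shifts a c l) (*Z-by-shifts b d l))
                     (cong₂ ℤ._+_ (*Z-by-shifts a d l) (*Z-by-shifts b c l)) ⟨
    ((a *Z c) l ℤ.+ (b *Z d) l) ℤ.- ((a *Z d) l ℤ.+ (b *Z c) l) ∎
    where
    open ≡-Reasoning
    C D : Fin n → ℤ
    C i = shift^ (toℕ i) c l
    D i = shift^ (toℕ i) d l
    expand : ∀ x y u v → (x ℤ.- y) ℤ.* (u ℤ.- v) ≡ (x ℤ.* u ℤ.+ y ℤ.* v) ℤ.- (x ℤ.* v ℤ.+ y ℤ.* u)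
    expand = solve-∀

infixl 6 _+ᵥ_
_+ᵥ_ : ∀ {m} → Vec ℕ m → Vec ℕ m → Vec ℕ m
_+ᵥ_ = zipWith ℕ._+_

infix 4 _<ₗ_ _≤ₗ_
_<ₗ_ _≤ₗ_ : ∀ {m} → Vec ℕ m → Vec ℕ m → Set
_<ₗ_ = Lex-< _≡_ ℕ._<_
_≤ₗ_ = Lex-≤ _≡_ ℕ._<_

private
  ≡-isPartialEquivalence : IsPartialEquivalence (_≡_ {A = ℕ})
  ≡-isPartialEquivalence = IsEquivalence.isPartialEquivalence ≡.isEquivalence

<ₗ-irrefl : ∀ {m} {a : Vec ℕ m} → ¬ a <ₗ a
<ₗ-irrefl = Lex.<-irrefl ℕP.<-irrefl (Pointwise.refl ≡.refl)

≤ₗ-refl : ∀ {m} {a : Vec ℕ m} → a ≤ₗ a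
≤ₗ-refl = Lex.≤-refl (Pointwise.refl ≡.refl)

≤ₗ-trans : ∀ {m} {a b c : Vec ℕ m} → a ≤ₗ b → b ≤ₗ c → a ≤ₗ c
≤ₗ-trans = Lex.≤-trans ≡-isPartialEquivalence ℕP.<-resp₂-≡ ℕP.<-trans

<ₗ-≤ₗ-trans : ∀ {m} {a b c : Vec ℕ m} → a <ₗ b → b ≤ₗ c → a <ₗ c
<ₗ-≤ₗ-trans = Lex.<-transˡ ≡-isPartialEquivalence ℕP.<-resp₂-≡ ℕP.<-trans

≤ₗ-<ₗ-trans : ∀ {m} {a b c : Vec ℕ m} → a ≤ₗ b → b <ₗ c → a <ₗ c
≤ₗ-<ₗ-trans = Lex.<-transʳ ≡-isPartialEquivalence ℕP.<-resp₂-≡ ℕP.<-trans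

≤ₗ-total : ∀ {m} (a b : Vec ℕ m) → a ≤ₗ b ⊎ b ≤ₗ a
≤ₗ-total = Lex.≤-total ≡.sym ℕP.<-cmp

≤ₗ⇒<ₗ⊎≡ : ∀ {m} {a b : Vec ℕ m} → a ≤ₗ b → a <ₗ b ⊎ a ≡ b
≤ₗ⇒<ₗ⊎≡ (base tt)           = inj₂ ≡.refl
≤ₗ⇒<ₗ⊎≡ (this x<y m≡n)      = inj₁ (this x<y m≡n)
≤ₗ⇒<ₗ⊎≡ (next ≡.refl a≤b) with ≤ₗ⇒<ₗ⊎≡ a≤b
... | inj₁ a<b    = inj₁ (next ≡.refl a<b)
... | inj₂ ≡.refl = inj₂ ≡.refl

≮ₗ⇒≥ₗ : ∀ {m} {a b : Vec ℕ m} → ¬ a <ₗ b → b ≤ₗ a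
≮ₗ⇒≥ₗ {a = a} {b} a≮b with ≤ₗ-total a b
... | inj₂ b≤a = b≤a
... | inj₁ a≤b with ≤ₗ⇒<ₗ⊎≡ a≤b
...   | inj₁ a<b    = contradiction a<b a≮b
...   | inj₂ ≡.refl = ≤ₗ-refl

≤ₗ-head : ∀ {m x y} {xs ys : Vec ℕ m} → (x ∷ xs) ≤ₗ (y ∷ ys) → x ℕ.≤ y
≤ₗ-head (this x<y _)    = ℕP.<⇒≤ x<y
≤ₗ-head (next ≡.refl _) = ℕP.≤-refl

+ᵥ-mono : ∀ {P Q : Set} {m} {a b c d : Vec ℕ m} →
          Lex P _≡_ ℕ._<_ a b → Lex Q _≡_ ℕ._<_ c d → Lex (P × Q) _≡_ ℕ._<_ (a +ᵥ c) (b +ᵥ d)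
+ᵥ-mono (base p)          (base q)          = base (p , q)
+ᵥ-mono (this x<y e)      (this u<v _)      = this (ℕP.+-mono-< x<y u<v) e
+ᵥ-mono (this x<y e)      (next ≡.refl _)   = this (ℕP.+-monoˡ-< _ x<y) e
+ᵥ-mono (next ≡.refl _)   (this u<v e)      = this (ℕP.+-monoʳ-< _ u<v) e
+ᵥ-mono (next ≡.refl a<b) (next ≡.refl c<d) = next ≡.refl (+ᵥ-mono a<b c<d)

+ᵥ-mono-<-≤ : ∀ {m} {a b c d : Vec ℕ m} → a <ₗ b → c ≤ₗ d → a +ᵥ c <ₗ b +ᵥ d
+ᵥ-mono-<-≤ a<b c≤d = map-P proj₁ (+ᵥ-mono a<b c≤d)

+ᵥ-mono-≤ : ∀ {m} {a b c d : Vec ℕ m} → a ≤ₗ b → c ≤ₗ d → a +ᵥ c ≤ₗ b +ᵥ d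
+ᵥ-mono-≤ a≤b c≤d = map-P (λ _ → tt) (+ᵥ-mono a≤b c≤d)

+ᵥ-cancelˡ : ∀ {m} (a : Vec ℕ m) {b c} → a +ᵥ b ≡ a +ᵥ c → b ≡ c
+ᵥ-cancelˡ []       {[]}     {[]}     _  = ≡.refl
+ᵥ-cancelˡ (x ∷ xs) {y ∷ ys} {z ∷ zs} eq with ℕP.+-cancelˡ-≡ x y z (VecP.∷-injectiveˡ eq)
... | ≡.refl = ≡.cong (y ∷_) (+ᵥ-cancelˡ xs (VecP.∷-injectiveʳ eq))

lookup-init : ∀ {A : Set} {r} (xs : Vec A (suc r)) i → lookup (init xs) i ≡ lookup xs (inject₁ i)
lookup-init (x ∷ y ∷ ys) zero    = ≡.refl
lookup-init (x ∷ y ∷ ys) (suc i) = lookup-init (y ∷ ys) i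

lookup-last : ∀ {A : Set} {r} (xs : Vec A (suc r)) → lookup xs (fromℕ r) ≡ last xs
lookup-last (x ∷ [])     = ≡.refl
lookup-last (x ∷ y ∷ ys) = lookup-last (y ∷ ys)

init∷ʳlast : ∀ {A : Set} {r} (xs : Vec A (suc r)) → init xs ∷ʳ last xs ≡ xs
init∷ʳlast xs = ≡.sym (proj₂ (proj₂ (initLast xs)))

lookup-extensional : ∀ {A : Set} {r} {a b : Vec A r} → (∀ i → lookup a i ≡ lookup b i) → a ≡ b
lookup-extensional {a = a} {b} a≗b =
  ≡.trans (≡.sym (VecP.tabulate∘lookup a)) (≡.trans (VecP.tabulate-cong a≗b) (VecP.tabulate∘lookup b))

-- Polynomials over a field

module _ {c ℓ} (F : Field c ℓ) where
  open Field F
  open import Relation.Binary.Reasoning.Setoid setoid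

  *-nonzero : ∀ {a b} → ¬ a ≈ 0# → ¬ b ≈ 0# → ¬ a * b ≈ 0#
  *-nonzero {a} {b} a≉0 b≉0 ab≈0 with inverse a a≉0
  ... | a⁻¹ , aa⁻¹≈1 = b≉0 (begin
    b                ≈⟨ *-identityˡ b ⟨
    1# * b           ≈⟨ *-congʳ (trans (sym aa⁻¹≈1) (*-comm a a⁻¹)) ⟩
    (a⁻¹ * a) * b    ≈⟨ *-assoc a⁻¹ a b ⟩
    a⁻¹ * (a * b)    ≈⟨ *-congˡ ab≈0 ⟩
    a⁻¹ * 0#         ≈⟨ zeroʳ a⁻¹ ⟩
    0#               ∎)

module Polynomials {c ℓ} (F : Field c ℓ) (q k : ℕ) where
  open Field F renaming (Carrier to K)
  open Setup F q k
  open import Relation.Binary.Reasoning.Setoid setoid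

  monomial : Exp → Poly
  monomial m = (1# , m) ∷ []

  infix 4 _∈supp_
  _∈supp_ : Exp → Poly → Set ℓ
  m ∈supp p = ¬ coeff p m ≈ 0#

  -- Coefficient identities for *P and starP are proved by pairing against test functions on exponents.
  pairing : (Exp → K) → Poly → K
  pairing h []             = 0#
  pairing h ((a , e) ∷ ts) = a * h e + pairing h ts

  indicator : Exp → Exp → K
  indicator m e with ≡-dec ℕ._≟_ e m
  ... | yes _ = 1#
  ... | no _  = 0#

  indicator-same : ∀ m → indicator m m ≈ 1#
  indicator-same m with ≡-dec ℕ._≟_ m m
  ... | yes _ = refl
  ... | no m≢m = contradiction ≡.refl m≢m

  indicator-other : ∀ {m e} → e ≢ m → indicator m e ≈ 0#
  indicator-other {m} {e} e≢m with ≡-dec ℕ._≟_ e m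
  ... | yes e≡m = contradiction e≡m e≢m
  ... | no _    = refl

  coeff≈pairing-indicator : ∀ p m → coeff p m ≈ pairing (indicator m) p
  coeff≈pairing-indicator []             m = refl
  coeff≈pairing-indicator ((a , e) ∷ ts) m with ≡-dec ℕ._≟_ e m
  ... | yes _ = +-cong (sym (*-identityʳ a)) (coeff≈pairing-indicator ts m)
  ... | no _  = trans (coeff≈pairing-indicator ts m) (sym (trans (+-congʳ (zeroʳ a)) (+-identityˡ _)))

  dropExponent : Exp → Poly → Poly
  dropExponent m [] = []
  dropExponent m ((a , e) ∷ ts) with ≡-dec ℕ._≟_ e m
  ... | yes _ = dropExponent m ts
  ... | no _  = (a , e) ∷ dropExponent m ts

  coeff-dropExponent-same : ∀ m p → coeff (dropExponent m p) m ≈ 0#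
  coeff-dropExponent-same m [] = refl
  coeff-dropExponent-same m ((a , e) ∷ ts) with ≡-dec ℕ._≟_ e m
  ... | yes _ = coeff-dropExponent-same m ts
  ... | no e≢m with ≡-dec ℕ._≟_ e m
  ...   | yes e≡m = contradiction e≡m e≢m
  ...   | no _    = coeff-dropExponent-same m ts

  coeff-dropExponent-other : ∀ {m m'} p → m' ≢ m → coeff (dropExponent m p) m' ≈ coeff p m'
  coeff-dropExponent-other [] _ = refl
  coeff-dropExponent-other {m} {m'} ((a , e) ∷ ts) m'≢m with ≡-dec ℕ._≟_ e m
  ... | yes ≡.refl with ≡-dec ℕ._≟_ e m'
  ...   | yes e≡m' = contradiction (≡.sym e≡m') m'≢m
  ...   | no _     = coeff-dropExponent-other ts m'≢m
  coeff-dropExponent-other {m} {m'} ((a , e) ∷ ts) m'≢m | no _ with ≡-dec ℕ._≟_ e m'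
  ...   | yes _ = +-congˡ (coeff-dropExponent-other ts m'≢m)
  ...   | no _  = coeff-dropExponent-other ts m'≢m

  length-dropExponent : ∀ m p → length (dropExponent m p) ℕ.≤ length p
  length-dropExponent m [] = ℕ.z≤n
  length-dropExponent m ((a , e) ∷ ts) with ≡-dec ℕ._≟_ e m
  ... | yes _ = ℕP.m≤n⇒m≤1+n (length-dropExponent m ts)
  ... | no _  = ℕ.s≤s (length-dropExponent m ts)

  length-dropExponent-head : ∀ a e ts → length (dropExponent e ((a , e) ∷ ts)) ℕ.≤ length ts
  length-dropExponent-head a e ts with ≡-dec ℕ._≟_ e e
  ... | yes _   = length-dropExponent e ts
  ... | no e≢e  = contradiction ≡.refl e≢e

  pairing-dropExponent : ∀ h m p → pairing h p ≈ coeff p m * h m + pairing h (dropExponent m p)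
  pairing-dropExponent h m [] = sym (trans (+-congʳ (zeroˡ _)) (+-identityˡ _))
  pairing-dropExponent h m ((a , e) ∷ ts) with ≡-dec ℕ._≟_ e m
  ... | yes ≡.refl = begin
    a * h e + pairing h ts                                     ≈⟨ +-congˡ (pairing-dropExponent h e ts) ⟩
    a * h e + (coeff ts e * h e + pairing h (dropExponent e ts))    ≈⟨ +-assoc _ _ _ ⟨
    (a * h e + coeff ts e * h e) + pairing h (dropExponent e ts)    ≈⟨ +-congʳ (distribʳ (h e) a (coeff ts e)) ⟨
    (a + coeff ts e) * h e + pairing h (dropExponent e ts)          ∎
  ... | no _ = begin
    a * h e + pairing h ts                                     ≈⟨ +-congˡ (pairing-dropExponent h m ts) ⟩
    a * h e + (coeff ts m * h m + pairing h (dropExponent m ts))    ≈⟨ +-assoc _ _ _ ⟨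
    (a * h e + coeff ts m * h m) + pairing h (dropExponent m ts)    ≈⟨ +-congʳ (+-comm _ _) ⟩
    (coeff ts m * h m + a * h e) + pairing h (dropExponent m ts)    ≈⟨ +-assoc _ _ _ ⟩
    coeff ts m * h m + (a * h e + pairing h (dropExponent m ts))    ∎

  pairing-resp-support : ∀ h p p' → (∀ e → coeff p e * h e ≈ coeff p' e * h e) → pairing h p ≈ pairing h p'
  pairing-resp-support h p p' = go (length p ℕ.+ length p') p p' ℕP.≤-refl
    where
    split : ∀ m {p p'} → (∀ e → coeff p e * h e ≈ coeff p' e * h e) →
            ((∀ e → coeff (dropExponent m p) e * h e ≈ coeff (dropExponent m p') e * h e) →
             pairing h (dropExponent m p) ≈ pairing h (dropExponent m p')) →
            pairing h p ≈ pairing h p'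
    split m {p} {p'} same rest = begin
      pairing h p                                    ≈⟨ pairing-dropExponent h m p ⟩
      coeff p m * h m + pairing h (dropExponent m p)      ≈⟨ +-cong (same m) (rest same-dropped) ⟩
      coeff p' m * h m + pairing h (dropExponent m p')    ≈⟨ pairing-dropExponent h m p' ⟨
      pairing h p'                                   ∎
      where
      same-dropped : ∀ e → coeff (dropExponent m p) e * h e ≈ coeff (dropExponent m p') e * h e
      same-dropped e with ≡-dec ℕ._≟_ e m
      ... | yes ≡.refl = *-congʳ (trans (coeff-dropExponent-same e p) (sym (coeff-dropExponent-same e p')))
      ... | no e≢m     = trans (*-congʳ (coeff-dropExponent-other p e≢m))
                           (trans (same e) (*-congʳ (sym (coeff-dropExponent-other p' e≢m))))
    go : ∀ N p p' → length p ℕ.+ length p' ℕ.≤ N →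
         (∀ e → coeff p e * h e ≈ coeff p' e * h e) → pairing h p ≈ pairing h p'
    go N       []      []      _  _ = refl
    go zero    (_ ∷ _) _       ()
    go zero    []      (_ ∷ _) ()
    go (suc N) ((a , e) ∷ ts) p' (ℕ.s≤s bound) same =
      split e {(a , e) ∷ ts} {p'} same (go N (dropExponent e ((a , e) ∷ ts)) (dropExponent e p')
        (ℕP.≤-trans (ℕP.+-mono-≤ (length-dropExponent-head a e ts) (length-dropExponent e p')) bound))
    go (suc N) [] ((a , e) ∷ ts) (ℕ.s≤s bound) same =
      split e {[]} {(a , e) ∷ ts} same (go N [] (dropExponent e ((a , e) ∷ ts))
        (ℕP.≤-trans (length-dropExponent-head a e ts) bound))

  pairing-vanish : ∀ h p → (∀ e → coeff p e * h e ≈ 0#) → pairing h p ≈ 0#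
  pairing-vanish h p vanish = pairing-resp-support h p [] (λ e → trans (vanish e) (sym (zeroˡ (h e))))

  pairing-single : ∀ h p m → (∀ e → e ≢ m → coeff p e * h e ≈ 0#) → pairing h p ≈ coeff p m * h m
  pairing-single h p m others = trans (pairing-resp-support h p ((coeff p m , m) ∷ []) same) (+-identityʳ _)
    where
    same : ∀ e → coeff p e * h e ≈ coeff ((coeff p m , m) ∷ []) e * h e
    same e with ≡-dec ℕ._≟_ m e
    ... | yes ≡.refl = *-congʳ (sym (+-identityʳ _))
    ... | no m≢e     = trans (others e (λ e≡m → m≢e (≡.sym e≡m))) (sym (zeroˡ (h e)))

  pairing-resp : ∀ h p p' → p ≈P p' → pairing h p ≈ pairing h p'
  pairing-resp h p p' p≈p' = pairing-resp-support h p p' (λ e → *-congʳ (p≈p' e))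

  pairing-congʰ : ∀ {h h'} p → (∀ e → h e ≈ h' e) → pairing h p ≈ pairing h' p
  pairing-congʰ []             h≈h' = refl
  pairing-congʰ ((a , e) ∷ ts) h≈h' = +-cong (*-congˡ (h≈h' e)) (pairing-congʰ ts h≈h')

  pairing-++ : ∀ h p r → pairing h (p ++ r) ≈ pairing h p + pairing h r
  pairing-++ h []             r = sym (+-identityˡ _)
  pairing-++ h ((a , e) ∷ ts) r = trans (+-congˡ (pairing-++ h ts r)) (sym (+-assoc _ _ _))

  pairing-shiftedTerms : ∀ h a e r →
    pairing h (map (λ u → (a * proj₁ u , e +ᵥ proj₂ u)) r) ≈ a * pairing (λ e' → h (e +ᵥ e')) r
  pairing-shiftedTerms h a e []              = sym (zeroʳ a)
  pairing-shiftedTerms h a e ((b , e') ∷ ts) = begin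
    (a * b) * h (e +ᵥ e') + pairing h (map _ ts)                   ≈⟨ +-cong (*-assoc a b _) (pairing-shiftedTerms h a e ts) ⟩
    a * (b * h (e +ᵥ e')) + a * pairing (λ e' → h (e +ᵥ e')) ts    ≈⟨ distribˡ a _ _ ⟨
    a * (b * h (e +ᵥ e') + pairing (λ e' → h (e +ᵥ e')) ts)        ∎

  pairing-*P : ∀ h p r → pairing h (p *P r) ≈ pairing (λ e → pairing (λ e' → h (e +ᵥ e')) r) p
  pairing-*P h []             r = refl
  pairing-*P h ((a , e) ∷ ts) r =
    trans (pairing-++ h (map _ r) (ts *P r)) (+-cong (pairing-shiftedTerms h a e r) (pairing-*P h ts r))

  coeff-*P : ∀ p r m → coeff (p *P r) m ≈ pairing (λ e → pairing (λ e' → indicator m (e +ᵥ e')) r) p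
  coeff-*P p r m = trans (coeff≈pairing-indicator (p *P r) m) (pairing-*P (indicator m) p r)

  *P-cong : ∀ {p p' r r'} → p ≈P p' → r ≈P r' → (p *P r) ≈P (p' *P r')
  *P-cong {p} {p'} {r} {r'} p≈p' r≈r' m = begin
    coeff (p *P r) m                                             ≈⟨ coeff-*P p r m ⟩
    pairing (λ e → pairing (λ e' → indicator m (e +ᵥ e')) r) p   ≈⟨ pairing-congʰ p (λ e → pairing-resp _ r r' r≈r') ⟩
    pairing (λ e → pairing (λ e' → indicator m (e +ᵥ e')) r') p  ≈⟨ pairing-resp _ p p' p≈p' ⟩
    pairing (λ e → pairing (λ e' → indicator m (e +ᵥ e')) r') p' ≈⟨ coeff-*P p' r' m ⟨
    coeff (p' *P r') m                                           ∎

  pairing-starP : ∀ h p → pairing h (starP p) ≈ pairing (λ e → h (starExp e)) p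
  pairing-starP h []             = refl
  pairing-starP h ((a , e) ∷ ts) = +-congˡ (pairing-starP h ts)

  starP-cong : ∀ {p p'} → p ≈P p' → starP p ≈P starP p'
  starP-cong {p} {p'} p≈p' m = begin
    coeff (starP p) m                              ≈⟨ coeff≈pairing-indicator (starP p) m ⟩
    pairing (indicator m) (starP p)                ≈⟨ pairing-starP (indicator m) p ⟩
    pairing (λ e → indicator m (starExp e)) p      ≈⟨ pairing-resp _ p p' p≈p' ⟩
    pairing (λ e → indicator m (starExp e)) p'     ≈⟨ pairing-starP (indicator m) p' ⟨
    pairing (indicator m) (starP p')               ≈⟨ coeff≈pairing-indicator (starP p') m ⟨
    coeff (starP p') m                             ∎

  key : Fin n → Exp → Vec ℕ (suc n)
  key j m = lookup m j ∷ m

  key-+ᵥ : ∀ j a b → key j (a +ᵥ b) ≡ key j a +ᵥ key j b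
  key-+ᵥ j a b = ≡.cong (_∷ (a +ᵥ b)) (VecP.lookup-zipWith ℕ._+_ j a b)

  ≤ₗ-key-≢⇒<ₗ : ∀ {j a b} → key j a ≤ₗ key j b → a ≢ b → key j a <ₗ key j b
  ≤ₗ-key-≢⇒<ₗ a≤b a≢b with ≤ₗ⇒<ₗ⊎≡ a≤b
  ... | inj₁ a<b = a<b
  ... | inj₂ eq  = contradiction (VecP.∷-injectiveʳ eq) a≢b

  record IsLeading (j : Fin n) (p : Poly) (m : Exp) : Set ℓ where
    constructor leading
    field
      leading∈supp : m ∈supp p
      above-vanish : ∀ m' → key j m <ₗ key j m' → coeff p m' ≈ 0#

  leading-dominates : ∀ {j p m m'} → IsLeading j p m → m' ∈supp p → key j m' ≤ₗ key j m
  leading-dominates {m' = m'} (leading _ above) m'∈p = ≮ₗ⇒≥ₗ (λ m<m' → m'∈p (above m' m<m'))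

  record HasDegree (j : Fin n) (p : Poly) (d : ℤ) : Set ℓ where
    constructor degree
    field
      attained        : Exp
      attained∈supp   : attained ∈supp p
      attained-degree : + lookup attained j ≡ d
      bounded         : ∀ m → m ∈supp p → + lookup m j ℤ.≤ d

  degree-unique : ∀ {j p d d'} → HasDegree j p d → HasDegree j p d' → d ≡ d'
  degree-unique (degree m m∈p ≡.refl bound) (degree m' m'∈p ≡.refl bound') =
    ℤP.≤-antisym (bound' m m∈p) (bound m' m'∈p)

  degree-nonzero : ∀ {j p d} → HasDegree j p d → ¬ p ≈P zeroP
  degree-nonzero (degree m m∈p _ _) p≈0 = m∈p (p≈0 m)

  degree-resp : ∀ {j p p' d} → p ≈P p' → HasDegree j p d → HasDegree j p' d
  degree-resp p≈p' (degree m m∈p e bound) =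
    degree m (λ c≈0 → m∈p (trans (p≈p' m) c≈0)) e (λ m' m'∈p' → bound m' (λ c≈0 → m'∈p' (trans (sym (p≈p' m')) c≈0)))

  leading⇒degree : ∀ {j p m} → IsLeading j p m → HasDegree j p (+ lookup m j)
  leading⇒degree {m = m} lead = degree m (IsLeading.leading∈supp lead) ≡.refl
    (λ m' m'∈p → ℤ.+≤+ (≤ₗ-head (leading-dominates lead m'∈p)))

  coeff-monomial-same : ∀ m → coeff (monomial m) m ≈ 1#
  coeff-monomial-same m with ≡-dec ℕ._≟_ m m
  ... | yes _   = +-identityʳ 1#
  ... | no m≢m  = contradiction ≡.refl m≢m

  coeff-single-other : ∀ {a m m'} → m ≢ m' → coeff ((a , m) ∷ []) m' ≈ 0#
  coeff-single-other {a} {m} {m'} m≢m' with ≡-dec ℕ._≟_ m m'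
  ... | yes m≡m' = contradiction m≡m' m≢m'
  ... | no _     = refl

  monomial-leading : ∀ j m → IsLeading j (monomial m) m
  monomial-leading j m = leading (λ 1≈0 → 1≉0 (trans (sym (coeff-monomial-same m)) 1≈0)) above
    where
    above : ∀ m' → key j m <ₗ key j m' → coeff (monomial m) m' ≈ 0#
    above m' m<m' = coeff-single-other {1#} {m} {m'} (λ { ≡.refl → <ₗ-irrefl m<m' })

  module _ (_≈?_ : Decidable _≈_) where

    ∉supp⇒≈0 : ∀ p {m} → ¬ m ∈supp p → coeff p m ≈ 0#
    ∉supp⇒≈0 p {m} = decidable-stable (coeff p m ≈? 0#)

    private
      vanishes-off-support : ∀ p (H : Exp → K) e → (e ∈supp p → H e ≈ 0#) → coeff p e * H e ≈ 0#
      vanishes-off-support p H e H≈0 with coeff p e ≈? 0#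
      ... | yes c≈0 = trans (*-congʳ c≈0) (zeroˡ _)
      ... | no e∈p  = trans (*-congˡ (H≈0 e∈p)) (zeroʳ _)

    coeff-*P-vanish : ∀ p r M → (∀ e e' → e ∈supp p → e' ∈supp r → e +ᵥ e' ≢ M) → coeff (p *P r) M ≈ 0#
    coeff-*P-vanish p r M avoid = trans (coeff-*P p r M)
      (pairing-vanish H p λ e → vanishes-off-support p H e λ e∈p →
        pairing-vanish (λ e' → indicator M (e +ᵥ e')) r λ e' →
          vanishes-off-support r (λ e' → indicator M (e +ᵥ e')) e' λ e'∈r →
            indicator-other (avoid e e' e∈p e'∈r))
      where
      H : Exp → K
      H e = pairing (λ e' → indicator M (e +ᵥ e')) r

    coeff-*P-single : ∀ p r m₁ m₂ → (∀ e e' → e ∈supp p → e' ∈supp r → e ≢ m₁ → e +ᵥ e' ≢ m₁ +ᵥ m₂) →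
                      coeff (p *P r) (m₁ +ᵥ m₂) ≈ coeff p m₁ * coeff r m₂
    coeff-*P-single p r m₁ m₂ unique = begin
      coeff (p *P r) M                 ≈⟨ coeff-*P p r M ⟩
      pairing H p                      ≈⟨ pairing-single H p m₁ others ⟩
      coeff p m₁ * H m₁                ≈⟨ *-congˡ (pairing-single _ r m₂ others') ⟩
      coeff p m₁ * (coeff r m₂ * indicator M M)  ≈⟨ *-congˡ (trans (*-congˡ (indicator-same M)) (*-identityʳ _)) ⟩
      coeff p m₁ * coeff r m₂          ∎
      where
      M : Exp
      M = m₁ +ᵥ m₂
      H : Exp → K
      H e = pairing (λ e' → indicator M (e +ᵥ e')) r
      others : ∀ e → e ≢ m₁ → coeff p e * H e ≈ 0#
      others e e≢m₁ = vanishes-off-support p H e λ e∈p →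
        pairing-vanish (λ e' → indicator M (e +ᵥ e')) r λ e' →
          vanishes-off-support r (λ e' → indicator M (e +ᵥ e')) e' λ e'∈r →
            indicator-other (unique e e' e∈p e'∈r e≢m₁)
      others' : ∀ e' → e' ≢ m₂ → coeff r e' * indicator M (m₁ +ᵥ e') ≈ 0#
      others' e' e'≢m₂ = trans (*-congˡ (indicator-other (λ eq → e'≢m₂ (+ᵥ-cancelˡ m₁ eq)))) (zeroʳ _)

    private
      Occurs : Exp → Poly → Set c
      Occurs m ts = Any (λ t → proj₂ t ≡ m) ts

      ∈supp⇒occurs : ∀ {m} p → m ∈supp p → Occurs m p
      ∈supp⇒occurs []             m∈p = contradiction refl m∈p
      ∈supp⇒occurs {m} ((a , e) ∷ ts) m∈p with ≡-dec ℕ._≟_ e m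
      ... | yes e≡m = here e≡m
      ... | no _    = there (∈supp⇒occurs ts m∈p)

      greatest : ∀ j p ts → (∀ m → Occurs m ts → coeff p m ≈ 0#)
                          ⊎ Σ Exp (λ m → m ∈supp p × (∀ m' → Occurs m' ts → m' ∈supp p → key j m' ≤ₗ key j m))
      greatest j p [] = inj₁ (λ _ ())
      greatest j p ((_ , e) ∷ ts) with greatest j p ts | coeff p e ≈? 0#
      ... | inj₁ none | yes e∉p = inj₁ λ { _ (here ≡.refl) → e∉p ; m (there o) → none m o }
      ... | inj₁ none | no e∈p  = inj₂ (e , e∈p , λ { _ (here ≡.refl) _ → ≤ₗ-refl
                                                     ; m' (there o) m'∈p → contradiction (none m' o) m'∈p })
      ... | inj₂ (m , m∈p , top) | yes e∉p = inj₂ (m , m∈p , λ { _ (here ≡.refl) e∈p → contradiction e∉p e∈p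
                                                                ; m' (there o) → top m' o })
      ... | inj₂ (m , m∈p , top) | no e∈p with ≤ₗ-total (key j e) (key j m)
      ...   | inj₁ e≤m = inj₂ (m , m∈p , λ { _ (here ≡.refl) _ → e≤m ; m' (there o) → top m' o })
      ...   | inj₂ m≤e = inj₂ (e , e∈p , λ { _ (here ≡.refl) _ → ≤ₗ-refl
                                            ; m' (there o) m'∈p → ≤ₗ-trans (top m' o m'∈p) m≤e })

    leading-exists : ∀ j p → ¬ p ≈P zeroP → ∃ (IsLeading j p)
    leading-exists j p p≉0 with greatest j p p
    ... | inj₁ none = contradiction (λ m → ∉supp⇒≈0 p (λ m∈p → m∈p (none m (∈supp⇒occurs p m∈p)))) p≉0
    ... | inj₂ (m , m∈p , top) =
      m , leading m∈p λ m' m<m' → ∉supp⇒≈0 p (λ m'∈p → <ₗ-irrefl (<ₗ-≤ₗ-trans m<m' (top m' (∈supp⇒occurs p m'∈p) m'∈p)))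

    leading-*P : ∀ {j p r m₁ m₂} → IsLeading j p m₁ → IsLeading j r m₂ → IsLeading j (p *P r) (m₁ +ᵥ m₂)
    leading-*P {j} {p} {r} {m₁} {m₂} lead₁ lead₂ = leading in-support above
      where
      sum-below : ∀ e e' → e ∈supp p → e' ∈supp r → key j (e +ᵥ e') ≤ₗ key j (m₁ +ᵥ m₂)
      sum-below e e' e∈p e'∈r rewrite key-+ᵥ j e e' | key-+ᵥ j m₁ m₂ =
        +ᵥ-mono-≤ (leading-dominates lead₁ e∈p) (leading-dominates lead₂ e'∈r)
      in-support : (m₁ +ᵥ m₂) ∈supp (p *P r)
      in-support c≈0 = *-nonzero F (IsLeading.leading∈supp lead₁) (IsLeading.leading∈supp lead₂) (trans (sym (coeff-*P-single p r m₁ m₂ unique)) c≈0)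
        where
        unique : ∀ e e' → e ∈supp p → e' ∈supp r → e ≢ m₁ → e +ᵥ e' ≢ m₁ +ᵥ m₂
        unique e e' e∈p e'∈r e≢m₁ eq = <ₗ-irrefl (≡.subst (λ x → key j x <ₗ key j (m₁ +ᵥ m₂)) eq strictly-below)
          where
          strictly-below : key j (e +ᵥ e') <ₗ key j (m₁ +ᵥ m₂)
          strictly-below rewrite key-+ᵥ j e e' | key-+ᵥ j m₁ m₂ =
            +ᵥ-mono-<-≤ (≤ₗ-key-≢⇒<ₗ (leading-dominates lead₁ e∈p) e≢m₁) (leading-dominates lead₂ e'∈r)
      above : ∀ M → key j (m₁ +ᵥ m₂) <ₗ key j M → coeff (p *P r) M ≈ 0#
      above M m<M = coeff-*P-vanish p r M λ e e' e∈p e'∈r eq →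
        <ₗ-irrefl (≤ₗ-<ₗ-trans (≡.subst (λ x → key j x ≤ₗ key j (m₁ +ᵥ m₂)) eq (sum-below e e' e∈p e'∈r)) m<M)

    degree-exists : ∀ j p → ¬ p ≈P zeroP → ∃ (HasDegree j p)
    degree-exists j p p≉0 with leading-exists j p p≉0
    ... | m , lead = + lookup m j , leading⇒degree lead

    degree-*P : ∀ {j p r d₁ d₂} → HasDegree j p d₁ → HasDegree j r d₂ → HasDegree j (p *P r) (d₁ ℤ.+ d₂)
    degree-*P {j} {p} {r} {d₁} {d₂} deg₁ deg₂
      with leading-exists j p (degree-nonzero deg₁) | leading-exists j r (degree-nonzero deg₂)
    ... | m₁ , lead₁ | m₂ , lead₂ =
      ≡.subst (HasDegree j (p *P r)) d≡ (leading⇒degree {p = p *P r} (leading-*P {p = p} {r} lead₁ lead₂))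
      where
      d≡ : + lookup (m₁ +ᵥ m₂) j ≡ d₁ ℤ.+ d₂
      d≡ = ≡.trans (≡.cong +_ (VecP.lookup-zipWith ℕ._+_ j m₁ m₂))
             (≡.trans (ℤP.pos-+ (lookup m₁ j) (lookup m₂ j))
               (≡.cong₂ ℤ._+_ (degree-unique {p = p} (leading⇒degree lead₁) deg₁) (degree-unique {p = r} (leading⇒degree lead₂) deg₂)))

  starP-support-image : ∀ {m'} p → m' ∈supp starP p → Σ Exp λ m → starExp m ≡ m'
  starP-support-image []             m'∈p* = contradiction refl m'∈p*
  starP-support-image {m'} ((a , e) ∷ ts) m'∈p* with ≡-dec ℕ._≟_ (starExp e) m'
  ... | yes e*≡m' = e , e*≡m'
  ... | no _      = starP-support-image ts m'∈p*

  module _ .{{q≢0 : ℕ.NonZero q}} where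

    starExp-injective : ∀ {a b} → starExp a ≡ starExp b → a ≡ b
    starExp-injective {a} {b} eq = ≡.trans (≡.sym (init∷ʳlast a)) (≡.trans
      (≡.cong₂ _∷ʳ_ (VecP.∷-injectiveʳ eq) (ℕP.*-cancelˡ-≡ _ _ q (VecP.∷-injectiveˡ eq)))
      (init∷ʳlast b))

    coeff-starP : ∀ p m → coeff (starP p) (starExp m) ≈ coeff p m
    coeff-starP p m = begin
      coeff (starP p) (starExp m)                       ≈⟨ coeff≈pairing-indicator (starP p) (starExp m) ⟩
      pairing (indicator (starExp m)) (starP p)         ≈⟨ pairing-starP _ p ⟩
      pairing (λ e → indicator (starExp m) (starExp e)) p ≈⟨ pairing-congʰ p same ⟩
      pairing (indicator m) p                           ≈⟨ coeff≈pairing-indicator p m ⟨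
      coeff p m                                         ∎
      where
      same : ∀ e → indicator (starExp m) (starExp e) ≈ indicator m e
      same e with ≡-dec ℕ._≟_ e m
      ... | yes ≡.refl = indicator-same (starExp e)
      ... | no e≢m     = indicator-other (λ eq → e≢m (starExp-injective eq))

    degree-starP : ∀ {p d} j j' (f : ℤ → ℤ) → (∀ m → + lookup (starExp m) j ≡ f (+ lookup m j')) →
                   (∀ {x y} → x ℤ.≤ y → f x ℤ.≤ f y) → HasDegree j' p d → HasDegree j (starP p) (f d)
    degree-starP {p} j j' f f-lookup f-mono (degree m m∈p ≡.refl bound) =
      degree (starExp m) (λ c≈0 → m∈p (trans (sym (coeff-starP p m)) c≈0)) (f-lookup m) bound*
      where
      bound* : ∀ m' → m' ∈supp starP p → + lookup m' j ℤ.≤ f (+ lookup m j')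
      bound* m' m'∈p* with starP-support-image p m'∈p*
      ... | m₀ , ≡.refl = ≡.subst (ℤ._≤ f (+ lookup m j')) (≡.sym (f-lookup m₀))
                            (f-mono (bound m₀ (λ c≈0 → m'∈p* (trans (coeff-starP p m₀) c≈0))))

-- Valuations

module Valuations {c ℓ} (F : Field c ℓ) (q k : ℕ) where
  open Field F renaming (Carrier to K) hiding (zero)
  open Setup F q k
  open Polynomials F q k
  open ZRootArithmetic q k

  -- Val p w: p has valuation w ∈ ℤⁿ.  The instances are the vector of x_j-degrees and "p ≈ x^w".
  record Valuation : Set (c ⊔ lsuc ℓ) where
    field
      Val          : Poly → ZRoot → Set ℓ
      Val-resp-≈P : ∀ {p p' w} → p ≈P p' → Val p w → Val p' w
      Val-resp-≈Z : ∀ {p w w'} → w ≈Z w' → Val p w → Val p w'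
      Val-*P      : ∀ {p r w w'} → Val p w → Val r w' → Val (p *P r) (λ j → w j ℤ.+ w' j)
      Val-monomial : ∀ m → Val (monomial m) (λ j → + lookup m j)
      Val-starP   : ∀ {p w} → Val p w → Val (starP p) (shift w)

  module Derived (V : Valuation) where
    open Valuation V

    Val-oneP : Val oneP (λ _ → + 0)
    Val-oneP = Val-resp-≈Z (λ j → ≡.cong +_ (VecP.lookup-replicate j 0)) (Val-monomial (replicate n 0))

    Val-powP : ∀ {p w} e → Val p w → Val (powP p e) (λ j → + e ℤ.* w j)
    Val-powP {w = w} zero    _  = Val-resp-≈Z (λ j → ≡.sym (ℤP.*-zeroˡ (w j))) Val-oneP
    Val-powP {w = w} (suc e) Vp = Val-resp-≈Z (λ j → ≡.sym (ℤP.suc-* (+ e) (w j))) (Val-*P Vp (Val-powP e Vp))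

    Val-prodFin : ∀ {m} (f : Fin m → Poly) (w : Fin m → ZRoot) → (∀ i → Val (f i) (w i)) →
                  Val (prodFin f) (λ j → sum (λ i → w i j))
    Val-prodFin {zero}  f w Vf = Val-oneP
    Val-prodFin {suc m} f w Vf =
      Val-*P (Vf zero) (Val-prodFin (λ i → f (suc i)) (λ i → w (suc i)) (λ i → Vf (suc i)))

    Val-iterStar : ∀ {g u v} → Val (num g) u → Val (den g) v →
                   ∀ i → Val (num (iterStar i g)) (shift^ i u) × Val (den (iterStar i g)) (shift^ i v)
    Val-iterStar Vu Vv zero    = Vu , Vv
    Val-iterStar Vu Vv (suc i) = Val-starP (proj₁ (Val-iterStar Vu Vv i)) , Val-starP (proj₂ (Val-iterStar Vu Vv i))

    Val-num-evalP-monomial : ∀ x rs (w : Fin n → ZRoot) → (∀ i → Val (num (rs i)) (w i)) →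
                             Val (num (evalP (monomial x) rs)) (λ l → sum (λ i → + lookup x i ℤ.* w i l))
    Val-num-evalP-monomial x rs w Vr =
      ≡.subst (λ p → Val p _) (≡.sym (ListP.++-identityʳ _))
        (Val-resp-≈Z (λ l → ≡.trans (ℤP.+-identityʳ _) (ℤP.+-identityˡ _))
          (Val-*P (Val-*P Val-oneP (Val-prodFin _ _ (λ i → Val-powP (lookup x i) (Vr i)))) Val-oneP))

    Val-den-evalP-monomial : ∀ x rs (w : Fin n → ZRoot) → (∀ i → Val (den (rs i)) (w i)) →
                             Val (den (evalP (monomial x) rs)) (λ l → sum (λ i → + lookup x i ℤ.* w i l))
    Val-den-evalP-monomial x rs w Vr =
      Val-resp-≈Z (λ l → ℤP.+-identityʳ _) (Val-*P (Val-prodFin _ _ (λ i → Val-powP (lookup x i) (Vr i))) Val-oneP)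

  pos neg : ZRoot → ZRoot
  pos e i = + posPart (e i)
  neg e i = + negPart (e i)

  pos-neg : ∀ e → e ≈Z (pos e -Z neg e)
  pos-neg e i with e i
  ... | + a      = ≡.sym (ℤP.+-identityʳ (+ a))
  ... | -[1+ a ] = ≡.refl

  -- The cross-multiplied equation of e ∘ g = h, read off on valuations (u − v of g, wn − wd of h).
  balanced⇔ : ∀ e u v wn wd →
    (∀ l → ((pos e *Z u) l ℤ.+ (neg e *Z v) l) ℤ.+ wd l ≡ wn l ℤ.+ ((pos e *Z v) l ℤ.+ (neg e *Z u) l))
    ⇔ ((e *Z (u -Z v)) ≈Z (wn -Z wd))
  balanced⇔ e u v wn wd = mk⇔
    (λ bal l → ≡.trans (expand l) (Equivalence.to (regroup l) (bal l)))
    (λ e*b≈w l → Equivalence.from (regroup l) (≡.trans (≡.sym (expand l)) (e*b≈w l)))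
    where
    same-sign opposite-sign : ZRoot
    same-sign l     = (pos e *Z u) l ℤ.+ (neg e *Z v) l
    opposite-sign l = (pos e *Z v) l ℤ.+ (neg e *Z u) l
    regroup : ∀ l → (same-sign l ℤ.+ wd l ≡ wn l ℤ.+ opposite-sign l) ⇔ (same-sign l ℤ.- opposite-sign l ≡ wn l ℤ.- wd l)
    regroup l = +≡+⇔-≡- (same-sign l) (opposite-sign l) (wn l) (wd l)
    expand : ∀ l → (e *Z (u -Z v)) l ≡ same-sign l ℤ.- opposite-sign l
    expand l = ≡.trans (*Z-cong (pos-neg e) (λ _ → ≡.refl) l) (*Z-expand (pos e) (neg e) u v l)

  sum≡*Z : ∀ (x : Fin n → ℕ) w l →
           sum (λ i → + lookup (tabulate x) i ℤ.* shift^ (toℕ i) w l) ≡ ((λ i → + x i) *Z w) l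
  sum≡*Z x w l = ≡.trans
    (sum-cong-≗ {n} (λ i → ≡.cong (λ y → + y ℤ.* shift^ (toℕ i) w l) (VecP.lookup∘tabulate x i)))
    (≡.sym (*Z-by-shifts (λ i → + x i) w l))

  module Composition (V : Valuation) (e : ZRoot) {g u v}
                     (Vu : Valuation.Val V (num g) u) (Vv : Valuation.Val V (den g) v) where
    open Valuation V
    open Derived V

    gs : Fin n → RatFun
    gs i = iterStar (toℕ i) g

    N D : RatFun
    N = evalP (num (mono e)) gs
    D = evalP (den (mono e)) gs

    private
      Val-num-at : ∀ (x : Fin n → ℕ) → Val (num (evalP (monomial (tabulate x)) gs)) ((λ i → + x i) *Z u)
      Val-num-at x = Val-resp-≈Z (sum≡*Z x u)
        (Val-num-evalP-monomial (tabulate x) gs _ (λ i → proj₁ (Val-iterStar Vu Vv (toℕ i))))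

      Val-den-at : ∀ (x : Fin n → ℕ) → Val (den (evalP (monomial (tabulate x)) gs)) ((λ i → + x i) *Z v)
      Val-den-at x = Val-resp-≈Z (sum≡*Z x v)
        (Val-den-evalP-monomial (tabulate x) gs _ (λ i → proj₂ (Val-iterStar Vu Vv (toℕ i))))

    Val-num-N : Val (num N) (pos e *Z u)
    Val-num-N = Val-num-at (λ i → posPart (e i))

    Val-den-N : Val (den N) (pos e *Z v)
    Val-den-N = Val-den-at (λ i → posPart (e i))

    Val-num-D : Val (num D) (neg e *Z u)
    Val-num-D = Val-num-at (λ i → negPart (e i))

    Val-den-D : Val (den D) (neg e *Z v)
    Val-den-D = Val-den-at (λ i → negPart (e i))

    Val-cross-left : ∀ {h wd} → Val (den h) wd →
      Val ((num N *P den D) *P den h) (λ l → ((pos e *Z u) l ℤ.+ (neg e *Z v) l) ℤ.+ wd l)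
    Val-cross-left Vd = Val-*P (Val-*P Val-num-N Val-den-D) Vd

    Val-cross-right : ∀ {h wn} → Val (num h) wn →
      Val (num h *P (den N *P num D)) (λ l → wn l ℤ.+ ((pos e *Z v) l ℤ.+ (neg e *Z u) l))
    Val-cross-right Vn = Val-*P Vn (Val-*P Val-den-N Val-num-D)

  module _ (V : Valuation)
           (Val-functional : ∀ {p r w w'} → Valuation.Val V p w → Valuation.Val V r w' → p ≈P r → w ≈Z w') where
    open Valuation V

    ∘-valuation : ∀ e {g h u v wn wd} → Val (num g) u → Val (den g) v → Val (num h) wn → Val (den h) wd →
                  Comp (mono e) g h → (e *Z (u -Z v)) ≈Z (wn -Z wd)
    ∘-valuation e {h = h} {u} {v} {wn} {wd} Vu Vv Vn Vd (_ , cross) =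
      Equivalence.to (balanced⇔ e u v wn wd) (Val-functional (Val-cross-left {h} Vd) (Val-cross-right {h} Vn) cross)
      where open Composition V e Vu Vv

module ValuationInstances {c ℓ} (F : Field c ℓ) (q k : ℕ) where
  open Field F renaming (Carrier to K) hiding (zero)
  open Setup F q k
  open Polynomials F q k
  open ZRootArithmetic q k
  open Valuations F q k

  lookup-starExp : ∀ m → (λ j → + lookup (starExp m) j) ≈Z shift (λ j → + lookup m j)
  lookup-starExp m zero    = ≡.trans (ℤP.pos-* q (last m)) (≡.cong (λ x → + q ℤ.* + x) (≡.sym (lookup-last m)))
  lookup-starExp m (suc i) = ≡.cong +_ (lookup-init m i)

  record IsMonomial (p : Poly) (w : ZRoot) : Set ℓ where
    constructor isMonomial
    field
      exponent   : Exp
      exponent≈w : (λ j → + lookup exponent j) ≈Z w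
      p≈monomial : p ≈P monomial exponent

  single-term-cong : ∀ {a b} m → a ≈ b → ((a , m) ∷ []) ≈P ((b , m) ∷ [])
  single-term-cong {a} {b} m a≈b m' with ≡-dec ℕ._≟_ m m'
  ... | yes _ = +-congʳ a≈b
  ... | no _  = refl

  monomialValuation : Valuation
  monomialValuation = record
    { Val          = IsMonomial
    ; Val-resp-≈P  = λ p≈p' (isMonomial m m≈w p≈m) → isMonomial m m≈w (λ e → trans (sym (p≈p' e)) (p≈m e))
    ; Val-resp-≈Z  = λ w≈w' (isMonomial m m≈w p≈m) → isMonomial m (λ j → ≡.trans (m≈w j) (w≈w' j)) p≈m
    ; Val-*P       = monomial-*P
    ; Val-monomial = λ m → isMonomial m (λ _ → ≡.refl) (λ _ → refl)
    ; Val-starP    = monomial-starP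
    }
    where
    monomial-*P : ∀ {p r w w'} → IsMonomial p w → IsMonomial r w' → IsMonomial (p *P r) (λ j → w j ℤ.+ w' j)
    monomial-*P {p} {r} (isMonomial m m≈w p≈m) (isMonomial m' m'≈w' r≈m') = isMonomial (m +ᵥ m')
      (λ j → ≡.trans (≡.cong +_ (VecP.lookup-zipWith ℕ._+_ j m m'))
               (≡.trans (ℤP.pos-+ (lookup m j) (lookup m' j)) (≡.cong₂ ℤ._+_ (m≈w j) (m'≈w' j))))
      (λ e → trans (*P-cong {p} {monomial m} {r} {monomial m'} p≈m r≈m' e)
                   (single-term-cong (m +ᵥ m') (*-identityʳ 1#) e))
    monomial-starP : ∀ {p w} → IsMonomial p w → IsMonomial (starP p) (shift w)
    monomial-starP {p} (isMonomial m m≈w p≈m) = isMonomial (starExp m)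
      (λ j → ≡.trans (lookup-starExp m j) (shift^-cong m≈w 1 j))
      (starP-cong {p} {monomial m} p≈m)

  Val-of-monomial : ∀ (V : Valuation) {p w} → IsMonomial p w → Valuation.Val V p w
  Val-of-monomial V {p} (isMonomial m m≈w p≈m) =
    Val-resp-≈P {monomial m} {p} (λ e → sym (p≈m e)) (Val-resp-≈Z m≈w (Val-monomial m))
    where open Valuation V

  monomial-nonzero : ∀ {p w} → IsMonomial p w → ¬ p ≈P zeroP
  monomial-nonzero (isMonomial m _ p≈m) p≈0 =
    1≉0 (trans (sym (coeff-monomial-same m)) (trans (sym (p≈m m)) (p≈0 m)))

  monomial-exponent-unique : ∀ {p r w w'} → IsMonomial p w → IsMonomial r w' → p ≈P r → w ≈Z w'
  monomial-exponent-unique {p} {r} (isMonomial m m≈w p≈m) (isMonomial m' m'≈w' r≈m') p≈r j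
    with ≡-dec ℕ._≟_ m' m
  ... | yes ≡.refl = ≡.trans (≡.sym (m≈w j)) (m'≈w' j)
  ... | no m'≢m    = contradiction (begin
    1#                     ≈⟨ coeff-monomial-same m ⟨
    coeff (monomial m) m   ≈⟨ p≈m m ⟨
    coeff p m              ≈⟨ p≈r m ⟩
    coeff r m              ≈⟨ r≈m' m ⟩
    coeff (monomial m') m  ≈⟨ coeff-single-other m'≢m ⟩
    0#                     ∎) 1≉0
    where open import Relation.Binary.Reasoning.Setoid setoid

  monomial-determined : ∀ {p r w w'} → IsMonomial p w → IsMonomial r w' → w ≈Z w' → p ≈P r
  monomial-determined (isMonomial m m≈w p≈m) (isMonomial m' m'≈w' r≈m') w≈w' e =
    trans (p≈m e) (trans (≡.subst (λ x → coeff (monomial m) e ≈ coeff (monomial x) e) m≡m' refl) (sym (r≈m' e)))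
    where
    m≡m' : m ≡ m'
    m≡m' = lookup-extensional λ j → ℤP.+-injective (≡.trans (m≈w j) (≡.trans (w≈w' j) (≡.sym (m'≈w' j))))

  module _ (_≈?_ : Decidable _≈_) .{{q≢0 : ℕ.NonZero q}} where

    degreeValuation : Valuation
    degreeValuation = record
      { Val          = λ p w → ∀ j → HasDegree j p (w j)
      ; Val-resp-≈P  = λ p≈p' deg j → degree-resp p≈p' (deg j)
      ; Val-resp-≈Z  = λ {p} w≈w' deg j → ≡.subst (HasDegree j p) (w≈w' j) (deg j)
      ; Val-*P       = λ deg₁ deg₂ j → degree-*P _≈?_ (deg₁ j) (deg₂ j)
      ; Val-monomial = λ m j → leading⇒degree (monomial-leading j m)
      ; Val-starP    = degrees-starP
      }
      where
      degrees-starP : ∀ {p w} → (∀ j → HasDegree j p (w j)) → ∀ j → HasDegree j (starP p) (shift w j)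
      degrees-starP deg zero    = degree-starP zero (fromℕ k) (+ q ℤ.*_) (λ m → lookup-starExp m zero)
                                    (ℤP.*-monoˡ-≤-nonNeg (+ q)) (deg (fromℕ k))
      degrees-starP deg (suc i) = degree-starP (suc i) (inject₁ i) id (λ m → lookup-starExp m (suc i))
                                    id (deg (inject₁ i))

    degrees-unique : ∀ {p r w w'} → (∀ j → HasDegree j p (w j)) → (∀ j → HasDegree j r (w' j)) →
                     p ≈P r → w ≈Z w'
    degrees-unique deg-p deg-r p≈r j = degree-unique (degree-resp p≈r (deg-p j)) (deg-r j)

-- Monomial maps

module MonomialMaps {c ℓ} (F : Field c ℓ) (q k : ℕ) where
  open Field F renaming (Carrier to K) hiding (zero)
  open Setup F q k
  open Polynomials F q k
  open ZRootArithmetic q k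
  open Valuations F q k
  open ValuationInstances F q k

  mono-num : ∀ e → IsMonomial (num (mono e)) (pos e)
  mono-num e = isMonomial (tabulate (λ i → posPart (e i)))
    (λ i → ≡.cong +_ (VecP.lookup∘tabulate (λ i → posPart (e i)) i)) (λ _ → refl)

  mono-den : ∀ e → IsMonomial (den (mono e)) (neg e)
  mono-den e = isMonomial (tabulate (λ i → negPart (e i)))
    (λ i → ≡.cong +_ (VecP.lookup∘tabulate (λ i → negPart (e i)) i)) (λ _ → refl)

  x0-num : IsMonomial (num x0) oneZ
  x0-num = isMonomial (replicate n 0 [ zero ]≔ 1) lookup≈oneZ (λ _ → refl)
    where
    lookup≈oneZ : (λ j → + lookup (replicate n 0 [ zero ]≔ 1) j) ≈Z oneZ
    lookup≈oneZ zero    = ≡.refl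
    lookup≈oneZ (suc i) = ≡.cong +_ (VecP.lookup-replicate i 0)

  x0-den : IsMonomial (den x0) (λ _ → + 0)
  x0-den = isMonomial (replicate n 0) (λ j → ≡.cong +_ (VecP.lookup-replicate j 0)) (λ _ → refl)

  ∘-monomials : ∀ a b {h wn wd} → IsMonomial (num h) wn → IsMonomial (den h) wd →
                (a *Z b) ≈Z (wn -Z wd) → Comp (mono a) (mono b) h
  ∘-monomials a b {h} {wn} {wd} Vn Vd ab≈w =
    monomial-nonzero Val-num-D ,
    monomial-determined (Val-cross-left {h} Vd) (Val-cross-right {h} Vn)
      (Equivalence.from (balanced⇔ a (pos b) (neg b) wn wd)
        (λ l → ≡.trans (*Z-cong (λ _ → ≡.refl) (λ i → ≡.sym (pos-neg b i)) l) (ab≈w l)))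
    where open Composition monomialValuation a (mono-num b) (mono-den b)

  ∘-mono : ∀ a b → Comp (mono a) (mono b) (mono (a *Z b))
  ∘-mono a b = ∘-monomials a b (mono-num (a *Z b)) (mono-den (a *Z b)) (pos-neg (a *Z b))

  ∘-mono-x0 : ∀ a b → (a *Z b) ≈Z oneZ → Comp (mono a) (mono b) x0
  ∘-mono-x0 a b ab≈1 =
    ∘-monomials a b x0-num x0-den (λ l → ≡.trans (ab≈1 l) (≡.sym (ℤP.+-identityʳ (oneZ l))))

  mono-injective : ∀ a b → mono a ≈R mono b → a ≈Z b
  mono-injective a b a≈b l = begin
    a l                   ≡⟨ pos-neg a l ⟩
    pos a l ℤ.- neg a l   ≡⟨ Equivalence.to (+≡+⇔-≡- (pos a l) (neg a l) (pos b l) (neg b l)) (cross-exponents l) ⟩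
    pos b l ℤ.- neg b l   ≡⟨ pos-neg b l ⟨
    b l                   ∎
    where
    open ≡.≡-Reasoning
    open Valuation monomialValuation using (Val-*P)
    cross-exponents : (λ j → pos a j ℤ.+ neg b j) ≈Z (λ j → pos b j ℤ.+ neg a j)
    cross-exponents =
      monomial-exponent-unique (Val-*P (mono-num a) (mono-den b)) (Val-*P (mono-num b) (mono-den a)) a≈b

  unit-nonzero : ∀ {e} → IsUnit e → ¬ (∀ i → e i ≡ + 0)
  unit-nonzero {e} (b , eb≈1 , _) e≈0 with ≡.trans (≡.sym (*Z-zeroˡ b e≈0 zero)) (eb≈1 zero)
  ... | ()

  mono-nonconstant : ∀ {e} → ¬ (∀ i → e i ≡ + 0) → ¬ IsConst (mono e)
  mono-nonconstant {e} e≉0 (a , num≈a*den) =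
    1≉0 (trans (sym (coeff-monomial-same poss)) (trans (num≈a*den poss) (coeff-single-other differ)))
    where
    poss negs : Exp
    poss = tabulate (λ i → posPart (e i))
    negs = tabulate (λ i → negPart (e i))
    differ : replicate n 0 +ᵥ negs ≢ poss
    differ same = e≉0 λ i →
      ≡.trans (pos-neg e i) (≡.trans (≡.cong (λ x → + x ℤ.- neg e i) (parts-equal i)) (ℤP.+-inverseʳ (neg e i)))
      where
      open ≡.≡-Reasoning
      parts-equal : ∀ i → posPart (e i) ≡ negPart (e i)
      parts-equal i = begin
        posPart (e i)                               ≡⟨ VecP.lookup∘tabulate (λ i → posPart (e i)) i ⟨
        lookup poss i                               ≡⟨ ≡.cong (λ v → lookup v i) same ⟨
        lookup (replicate n 0 +ᵥ negs) i            ≡⟨ VecP.lookup-zipWith ℕ._+_ i (replicate n 0) negs ⟩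
        lookup (replicate n 0) i ℕ.+ lookup negs i  ≡⟨ ≡.cong (ℕ._+ lookup negs i) (VecP.lookup-replicate i 0) ⟩
        lookup negs i                               ≡⟨ VecP.lookup∘tabulate (λ i → negPart (e i)) i ⟩
        negPart (e i)                               ∎

  mono-Elt : ∀ {e} → IsUnit e → Elt (mono e)
  mono-Elt {e} unit = monomial-nonzero (mono-den e) , mono-nonconstant (unit-nonzero unit)

  Elt-num-nonzero : ∀ {g} → Elt g → ¬ num g ≈P zeroP
  Elt-num-nonzero {g} (_ , nonconstant) num≈0 = nonconstant (0# , λ m → trans (num≈0 m) (sym (zero-multiple m)))
    where
    zero-multiple : ∀ m → coeff (constP 0# *P den g) m ≈ 0#
    zero-multiple m = trans (coeff-*P (constP 0#) (den g) m) (trans (+-identityʳ _) (zeroˡ _))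

  -- The degree vectors u, v of num g, den g give the inverse u − v of e.
  ∘-x0⇒unit : ∀ (_≈?_ : Decidable _≈_) .{{_ : ℕ.NonZero q}} e {g} → Elt g → Comp (mono e) g x0 → IsUnit e
  ∘-x0⇒unit _≈?_ e {g} g-elt e∘g≈x0 = u -Z v , eb≈1 , λ l → ≡.trans (*Z-comm (u -Z v) e l) (eb≈1 l)
    where
    deg-num : ∀ j → ∃ (HasDegree j (num g))
    deg-num j = degree-exists _≈?_ j (num g) (Elt-num-nonzero {g} g-elt)
    deg-den : ∀ j → ∃ (HasDegree j (den g))
    deg-den j = degree-exists _≈?_ j (den g) (proj₁ g-elt)
    u v : ZRoot
    u j = proj₁ (deg-num j)
    v j = proj₁ (deg-den j)
    degrees : Valuation
    degrees = degreeValuation _≈?_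
    eb≈1 : (e *Z (u -Z v)) ≈Z oneZ
    eb≈1 l = ≡.trans
      (∘-valuation degrees (degrees-unique _≈?_) e {g} {x0} (λ j → proj₂ (deg-num j)) (λ j → proj₂ (deg-den j))
         (Val-of-monomial degrees x0-num) (Val-of-monomial degrees x0-den) e∘g≈x0 l)
      (ℤP.+-identityʳ (oneZ l))

open ≡ using (setoid)

-- Only q ≠ 0 and the decidability of equality in F are used: the gcd condition ensures that x^n − q
-- is irreducible, which the coefficient-vector model of ℤ[q^{1/n}] already presupposes.

proposition4p3 : ∀ {c ℓ} (F : Field c ℓ) (p q k m : ℕ)
    → Prime p → 1 ≤ k → q ≡ p ^ k
    → Bijection (Field.setoid F) (setoid (Fin q))
    → gcd (suc m) k ≡ 1
    → let open Setup F q m in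
      (∀ (e : ZRoot) → InG (mono e) ⇔ IsUnit e)
      × (∀ (a b : ZRoot) → IsUnit a → IsUnit b → Comp (mono a) (mono b) (mono (a *Z b)))
      × (∀ (a b : ZRoot) → IsUnit a → IsUnit b → mono a ≈R mono b → a ≈Z b)
proposition4p3 F p q k m p-prime _ q≡p^k F↔Fin-q _ =
  (λ e → mk⇔ (λ { (_ , g , g-elt , e∘g≈x0 , _) → ∘-x0⇒unit _≈?_ e g-elt e∘g≈x0 })
             (λ { (b , eb≈1 , be≈1) → mono-Elt (b , eb≈1 , be≈1) , mono b , mono-Elt (e , be≈1 , eb≈1)
                                     , ∘-mono-x0 e b eb≈1 , ∘-mono-x0 b e be≈1 })) ,
  (λ a b _ _ → ∘-mono a b) ,
  (λ a b _ _ → mono-injective a b)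
  where
  open Setup F q m
  open MonomialMaps F q m
  _≈?_ : Decidable (Field._≈_ F)
  _≈?_ = via-injection (Bijection.injection F↔Fin-q) FinP._≟_
  instance
    q≢0 : ℕ.NonZero q
    q≢0 = ≡.subst ℕ.NonZero (≡.sym q≡p^k) (ℕP.m^n≢0 p k {{prime⇒nonZero p-prime}})
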